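{- Let $\mu$ be a nonempty partition. Then (1) $(\mu^c)'=(\mu')^r$, and (2) $(\mu^r)'=(\mu')^c$.
   Context: $\lambda'$ denotes the conjugate partition. For a partition $\lambda$ set $\lambda_t=0$ for $t>\ell(\lambda)$. The Maya diagram of $\lambda$ is $S(\lambda)=\{\lambda_t-t+\tfrac12:t\ge1\}$. For $S\subseteq\mathbb{Z}+\tfrac12$ let $S^+=\{x\in S:x>0\}$, $S^-=\{x\in(\mathbb{Z}+\tfrac12)\setminus S:x<0\}$; if finite, $c(S)=|S^+|-|S^-|$ and $\{s-c(S):s\in S\}$ is the Maya diagram of a unique partition, the partition associated to $S$. For nonempty $\mu$ with $S=S(\mu)$, $\mu^r$ is the partition associated to $S\setminus\{\min S^+\}$ and $\mu^c$ is the partition associated to $S\cup\{\max S^-\}$. -}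

module Defs where

open import Data.Nat as ℕ using (ℕ; zero; suc; _≤?_)
open import Data.Integer as ℤ using (ℤ; +_; _-_; _+_; _≤_; _<_)
open import Data.List using (List; []; _∷_; length; filter; applyUpTo)
open import Data.List.Relation.Unary.All using (All)
open import Data.List.Relation.Unary.Linked using (Linked)
open import Data.List.Relation.Unary.Unique.Propositional using (Unique)
open import Data.List.Membership.Propositional using (_∈_)
open import Data.Product using (Σ; _×_; ∃; ∃-syntax)
open import Data.Sum using (_⊎_)
open import Relation.Nullary using (¬_)
open import Relation.Binary.PropositionalEquality using (_≡_; _≢_)
open import Function.Bundles using (_⇔_)
open import Level using (0ℓ)
open import Relation.Unary using (Pred)

IsPartition : List ℕ → Set
IsPartition λs = Linked ℕ._≥_ λs × All (0 ℕ.<_) λs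

-- λ_t for t ≥ 1, with λ_t = 0 for t > ℓ(λ).  (entry λ 0 is unused.)
entry : List ℕ → ℕ → ℕ
entry []       _             = 0
entry (x ∷ xs) zero          = 0
entry (x ∷ xs) (suc zero)    = x
entry (x ∷ xs) (suc (suc t)) = entry xs (suc t)

conj : List ℕ → List ℕ
conj []         = []
conj (l ∷ rest) = applyUpTo (λ i → length (filter (λ x → suc i ≤? x) (l ∷ rest))) l

-- ENCODING: a half-integer x ∈ ℤ + 1/2 is represented by the integer k with x = k + 1/2.
-- So x > 0 ⟺ 0 ≤ k, x < 0 ⟺ k < 0, and a shift x ↦ x - c (c ∈ ℤ) is k ↦ k - c.
HSet : Set₁
HSet = Pred ℤ 0ℓ

-- Maya diagram S(λ) = { λ_t - t + 1/2 : t ≥ 1 }  (encoded: { λ_t - t }).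
Maya : List ℕ → HSet
Maya λs k = ∃[ t ] (1 ℕ.≤ t × (+ entry λs t) - (+ t) ≡ k)

Pos : HSet → HSet
Pos S k = S k × (+ 0) ≤ k

Neg : HSet → HSet
Neg S k = ¬ S k × k < (+ 0)

-- S⁺ and S⁻ are finite and c(S) = |S⁺| - |S⁻| (counted via duplicate-free enumerations).
HasCharge : HSet → ℤ → Set
HasCharge S c =
  Σ (List ℤ) λ P → Σ (List ℤ) λ N →
    Unique P × Unique N ×
    (∀ k → (k ∈ P) ⇔ Pos S k) ×
    (∀ k → (k ∈ N) ⇔ Neg S k) ×
    c ≡ (+ length P) - (+ length N)

IsAssociated : HSet → List ℕ → Set
IsAssociated S ν =
  IsPartition ν × Σ ℤ λ c → HasCharge S c × (∀ k → Maya ν k ⇔ S (k + c))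

IsMin : HSet → ℤ → Set
IsMin A m = A m × (∀ k → A k → m ≤ k)

IsMax : HSet → ℤ → Set
IsMax A m = A m × (∀ k → A k → k ≤ m)

IsRowRemoval : List ℕ → List ℕ → Set
IsRowRemoval μ ν =
  Σ ℤ λ m → IsMin (Pos (Maya μ)) m × IsAssociated (λ k → Maya μ k × k ≢ m) ν

IsColAddition : List ℕ → List ℕ → Set
IsColAddition μ ν =
  Σ ℤ λ m → IsMax (Neg (Maya μ)) m × IsAssociated (λ k → Maya μ k ⊎ k ≡ m) ν

module Submission where

open import Defs
open import Data.Nat as ℕ using (ℕ; zero; suc; z≤n; s≤s)
import Data.Nat.Properties as ℕ
open import Data.Integer as ℤ using (ℤ; +_; -[1+_]; _+_; _-_; -_; _≤_; _<_; 0ℤ; 1ℤ; -1ℤ; +≤+; +<+; -≤+; -<+; -≤-; -<-)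
import Data.Integer.Properties as ℤ
open import Data.Integer.Tactic.RingSolver using (solve-∀; solve)
open import Data.List using (List; []; _∷_; length; filter; applyUpTo)
open import Data.List.Properties using (length-applyUpTo; filter-accept; filter-reject; filter-all; filter-none)
open import Data.List.Membership.Propositional using (_∈_)
open import Data.List.Membership.Propositional.Properties using (∈-applyUpTo⁺; ∈-applyUpTo⁻; ∈-filter⁺; ∈-filter⁻)
open import Data.List.Relation.Binary.Sublist.Propositional using (⊆-refl)
import Data.List.Relation.Binary.Sublist.Heterogeneous.Properties as Sublist
open import Data.List.Relation.Unary.All as All using (All)
import Data.List.Relation.Unary.All.Properties as All
open import Data.List.Relation.Unary.AllPairs as AllPairs using ()
open import Data.List.Relation.Unary.Any using (here; there)
open import Data.List.Relation.Unary.Linked as Linked using (Linked)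
import Data.List.Relation.Unary.Linked.Properties as Linked
open import Data.List.Relation.Unary.Unique.Propositional using (Unique)
import Data.List.Relation.Unary.Unique.Propositional.Properties as Unique
open import Data.Product using (Σ; _×_; _,_; proj₁; proj₂; ∃-syntax; map₁)
open import Data.Product.Function.NonDependent.Propositional using (_×-⇔_)
open import Data.Sum using (_⊎_; inj₁; inj₂; [_,_])
open import Data.Sum.Function.Propositional using (_⊎-⇔_)
open import Function.Base using (_∘_)
open import Function.Bundles using (_⇔_; mk⇔; Equivalence)
import Function.Properties.Equivalence as ⇔
open import Function.Related.Propositional using (≡⇒; module EquationalReasoning)
open import Function.Related.TypeIsomorphisms using (¬-cong-⇔)
open import Relation.Binary.Definitions using (DecidableEquality)
open import Relation.Binary.PropositionalEquality using (_≡_; _≢_; refl; sym; trans; cong; subst; subst₂; module ≡-Reasoning)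
open import Relation.Nullary using (¬_; ¬?; yes; no; contradiction)
open import Relation.Nullary.Decidable using (map′; _⊎-dec_; decidable-stable)
open import Relation.Unary using (Decidable)

open Equivalence using (to; from)

-- The Maya diagram of λ' is the mirror image of the complement of that of λ: a half-integer x lies
-- in S(λ') iff -x ∉ S(λ); this follows by induction on the rows of λ, reading λ' as column lengths.
-- Taking mirror images of complements swaps S⁺ with S⁻, the maximum of S⁻ with the minimum of S⁺,
-- adding a point with removing one, and a shift by c with a shift by -c.  Hence the partition
-- associated to S(μ) ∪ {max S(μ)⁻} has as conjugate the partition associated to S(μ') ∖ {min S(μ')⁺},
-- and dually.  For existence, μ^r is built explicitly and μ^c = ((μ')^r)'; the charges needed along
-- the way are computed by adding the points of a Maya diagram one row at a time.

i<i+1 : ∀ i → i < i + 1ℤ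
i<i+1 i = ℤ.suc[i]≤j⇒i<j (ℤ.≤-reflexive (ℤ.+-comm 1ℤ i))

i-1<i : ∀ i → i - 1ℤ < i
i-1<i i = ℤ.i≤pred[j]⇒i<j (ℤ.≤-reflexive (ℤ.+-comm i -1ℤ))

<⇒≤-1 : ∀ {i j} → i < j → i ≤ j - 1ℤ
<⇒≤-1 {i} {j} i<j = subst (i ≤_) (ℤ.+-comm -1ℤ j) (ℤ.i<j⇒i≤pred[j] i<j)

≤⇒-1≤-1 : ∀ {i j} → i ≤ j → i - 1ℤ ≤ j - 1ℤ
≤⇒-1≤-1 = ℤ.+-monoˡ-≤ -1ℤ

≤+1⇒-1≤ : ∀ {i j} → i ≤ j + 1ℤ → i - 1ℤ ≤ j
≤+1⇒-1≤ {i} {j} i≤j+1 = subst (i - 1ℤ ≤_) (arith j) (≤⇒-1≤-1 i≤j+1)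
  where
  arith : ∀ j → j + 1ℤ - 1ℤ ≡ j
  arith = solve-∀

≤⇒1+≤+1 : ∀ {i j} → i ≤ j → 1ℤ + i ≤ j + 1ℤ
≤⇒1+≤+1 {i} {j} i≤j = subst (1ℤ + i ≤_) (ℤ.+-comm 1ℤ j) (ℤ.+-monoʳ-≤ 1ℤ i≤j)

<⇒-<0 : ∀ {i j} → i < j → i - j < 0ℤ
<⇒-<0 {i} {j} i<j = subst (i - j <_) (ℤ.+-inverseʳ j) (ℤ.+-monoˡ-< (- j) i<j)

-<0⇒< : ∀ {i j} → i - j < 0ℤ → i < j
-<0⇒< {i} {j} i-j<0 = subst₂ _<_ (arith i j) (ℤ.+-identityˡ j) (ℤ.+-monoˡ-< j i-j<0)
  where
  arith : ∀ i j → i - j + j ≡ i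
  arith = solve-∀

-≡⇔≡+ : ∀ {i c j} → (i - c ≡ j) ⇔ (i ≡ c + j)
-≡⇔≡+ {i} {c} {j} = mk⇔ (λ { refl → arith₁ i c }) (λ { refl → arith₂ c j })
  where
  arith₁ : ∀ i c → i ≡ c + (i - c)
  arith₁ = solve-∀
  arith₂ : ∀ c j → c + j - c ≡ j
  arith₂ = solve-∀

-≡-⇒+≡ : ∀ a b {x} → a - b ≡ - x → a + x ≡ b
-≡-⇒+≡ a b {x} eq = begin
  a + x            ≡⟨ arith a b x ⟩
  a - b + (b + x)  ≡⟨ cong (_+ (b + x)) eq ⟩
  - x + (b + x)    ≡⟨ arith′ b x ⟩
  b                ∎
  where
  open ≡-Reasoning
  arith : ∀ a b x → a + x ≡ a - b + (b + x)
  arith = solve-∀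
  arith′ : ∀ b x → - x + (b + x) ≡ b
  arith′ = solve-∀

-1≡-1⇔≡ : ∀ {i k} → (i - 1ℤ ≡ k - 1ℤ) ⇔ (i ≡ k)
-1≡-1⇔≡ {i} {k} = mk⇔ (λ eq → trans (to -≡⇔≡+ eq) (arith k)) (cong (_- 1ℤ))
  where
  arith : ∀ k → 1ℤ + (k - 1ℤ) ≡ k
  arith = solve-∀

absorb : ∀ {A C : Set} → (C → ¬ A) → C ⇔ ((A ⊎ C) × ¬ A)
absorb C⇒¬A = mk⇔ (λ c → inj₂ c , C⇒¬A c) λ { (inj₁ a , ¬a) → contradiction a ¬a ; (inj₂ c , _) → c }

⊎-×-distrib : ∀ {A C D : Set} → (A → D) → (A ⊎ (C × D)) ⇔ ((A ⊎ C) × D)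
⊎-×-distrib A⇒D =
  mk⇔ [ (λ a → inj₁ a , A⇒D a) , map₁ inj₂ ] λ { (inj₁ a , _) → inj₁ a ; (inj₂ c , d) → inj₂ (c , d) }

module _ {A : Set} (_≟_ : DecidableEquality A) where

  remove : A → List A → List A
  remove a = filter (λ k → ¬? (k ≟ a))

  length-remove : ∀ {a xs} → Unique xs → a ∈ xs → length xs ≡ suc (length (remove a xs))
  length-remove {xs = x ∷ xs} (x∉xs AllPairs.∷ _) (here refl) = cong suc (cong length (sym (begin
    remove x (x ∷ xs) ≡⟨ filter-reject (λ k → ¬? (k ≟ x)) (λ x≢x → x≢x refl) ⟩
    remove x xs       ≡⟨ filter-all (λ k → ¬? (k ≟ x)) (All.map (λ x≢k k≡x → x≢k (sym k≡x)) x∉xs) ⟩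
    xs                ∎)))
    where open ≡-Reasoning
  length-remove {a} {x ∷ xs} (x∉xs AllPairs.∷ xs!) (there a∈xs) with x ≟ a
  ... | yes refl = contradiction refl (All.lookup x∉xs a∈xs)
  ... | no _     = cong suc (length-remove xs! a∈xs)

linked⇒bounded : ∀ {x xs} → Linked ℕ._≥_ (x ∷ xs) → All (ℕ._≤ x) (x ∷ xs)
linked⇒bounded = Linked.Linked⇒All (λ x≥y y≥z → ℕ.≤-trans y≥z x≥y) ℕ.≤-refl

linked-∷ : ∀ {b R} → All (ℕ._≤ b) R → Linked ℕ._≥_ R → Linked ℕ._≥_ (b ∷ R)
linked-∷ {R = []}    _             _  = Linked.[-]
linked-∷ {R = _ ∷ _} (z≤b All.∷ _) R↓ = z≤b Linked.∷ R↓

-- Mirror images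

-- Under the encoding of Defs (k stands for k + 1/2), mirror is the reflection x ↦ -x.
mirror : ℤ → ℤ
mirror (+ n)    = -[1+ n ]
mirror -[1+ n ] = + n

mirror-involutive : ∀ k → mirror (mirror k) ≡ k
mirror-involutive (+ n)    = refl
mirror-involutive -[1+ n ] = refl

mirror-injective : ∀ {k m} → mirror k ≡ mirror m → k ≡ m
mirror-injective {k} {m} eq =
  trans (sym (mirror-involutive k)) (trans (cong mirror eq) (mirror-involutive m))

mirror-≡⇔ : ∀ {j m} → (mirror j ≡ m) ⇔ (j ≡ mirror m)
mirror-≡⇔ {j} {m} = mk⇔ (λ { refl → sym (mirror-involutive j) }) (λ { refl → mirror-involutive m })

mirror≡ : ∀ k → mirror k ≡ - k - 1ℤ
mirror≡ (+ zero)  = refl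
mirror≡ (+ suc n) = cong (λ m → -[1+ suc m ]) (sym (ℕ.+-identityʳ n))
mirror≡ -[1+ n ]  = refl

mirror-shift : ∀ k c → mirror (k - c) ≡ mirror k + c
mirror-shift k c = begin
  mirror (k - c)   ≡⟨ mirror≡ (k - c) ⟩
  - (k - c) - 1ℤ   ≡⟨ solve (k ∷ c ∷ []) ⟩
  - k - 1ℤ + c     ≡⟨ cong (_+ c) (mirror≡ k) ⟨
  mirror k + c     ∎
  where open ≡-Reasoning

mirror-neg : ∀ k → mirror (- k) ≡ k - 1ℤ
mirror-neg k = trans (mirror≡ (- k)) (cong (_- 1ℤ) (ℤ.neg-involutive k))

0≤⇒mirror<0 : ∀ {k} → 0ℤ ≤ k → mirror k < 0ℤ
0≤⇒mirror<0 {+ n} _ = -<+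

<0⇒0≤mirror : ∀ {k} → k < 0ℤ → 0ℤ ≤ mirror k
<0⇒0≤mirror { -[1+ n ]} _        = +≤+ z≤n
<0⇒0≤mirror {+ _}       (+<+ ())

mirror-antitone : ∀ {k m} → k ≤ m → mirror m ≤ mirror k
mirror-antitone (-≤- n≤m) = +≤+ n≤m
mirror-antitone -≤+       = -≤+
mirror-antitone (+≤+ m≤n) = -≤- m≤n

infix 4 _≐_
_≐_ : HSet → HSet → Set
S ≐ T = ∀ k → S k ⇔ T k

Dual : HSet → HSet
Dual S k = ¬ S (mirror k)

Dual-resp : ∀ {S T} → S ≐ T → Dual S ≐ Dual T
Dual-resp S≐T k = ¬-cong-⇔ (S≐T (mirror k))

Dual-involutive : ∀ {S} → Decidable S → Dual (Dual S) ≐ S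
Dual-involutive {S} S? k =
  ⇔.trans (mk⇔ (decidable-stable (S? _)) λ s ¬s → ¬s s) (≡⇒ (cong S (mirror-involutive k)))

Dual-insert : ∀ {S m} → Dual (λ k → S k ⊎ k ≡ m) ≐ (λ k → Dual S k × k ≢ mirror m)
Dual-insert k = mk⇔ (λ ¬∪ → ¬∪ ∘ inj₁ , ¬∪ ∘ inj₂ ∘ from mirror-≡⇔) (λ (¬S , k≢) → [ ¬S , k≢ ∘ to mirror-≡⇔ ])

Dual-delete : ∀ {S m} → Dual (λ k → S k × k ≢ m) ≐ (λ k → Dual S k ⊎ k ≡ mirror m)
Dual-delete {S} {m} k = mk⇔ split λ { (inj₁ ¬S) (S , _) → ¬S S ; (inj₂ refl) (_ , k≢) → k≢ (mirror-involutive m) }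
  where
  split : Dual (λ k → S k × k ≢ m) k → Dual S k ⊎ k ≡ mirror m
  split ¬S∖m with mirror k ℤ.≟ m
  ... | yes eq = inj₂ (to mirror-≡⇔ eq)
  ... | no  ne = inj₁ λ S → ¬S∖m (S , ne)

isMax-Neg⇒isMin-Pos-Dual : ∀ {S m} → IsMax (Neg S) m → IsMin (Pos (Dual S)) (mirror m)
isMax-Neg⇒isMin-Pos-Dual {S} {m} ((m∉S , m<0) , m-max) =
  (m∉S ∘ subst S (mirror-involutive m) , <0⇒0≤mirror m<0) ,
  λ k (k∉S , 0≤k) → subst (mirror m ≤_) (mirror-involutive k) (mirror-antitone (m-max (mirror k) (k∉S , 0≤⇒mirror<0 0≤k)))

-- Membership in Dual (Dual S) is only known up to double negation, but the bound is decidable.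
isMin-Pos⇒isMax-Neg-Dual : ∀ {S m} → IsMin (Pos S) m → IsMax (Neg (Dual S)) (mirror m)
isMin-Pos⇒isMax-Neg-Dual {S} {m} ((m∈S , 0≤m) , m-min) =
  ((λ m∉S → m∉S (subst S (sym (mirror-involutive m)) m∈S)) , 0≤⇒mirror<0 0≤m) ,
  λ k (¬k∉S , k<0) → decidable-stable (k ℤ.≤? mirror m) λ k≰ → ¬k∉S λ k∈S → k≰ (bound k k∈S k<0)
  where
  bound : ∀ k → S (mirror k) → k < 0ℤ → k ≤ mirror m
  bound k k∈S k<0 =
    subst (_≤ mirror m) (mirror-involutive k) (mirror-antitone (m-min (mirror k) (k∈S , <0⇒0≤mirror k<0)))

-- Maya diagrams

maya-[] : ∀ {k} → Maya [] k ⇔ k < 0ℤ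
maya-[] = mk⇔ (λ { (suc t , _ , refl) → -<+ }) witness
  where
  witness : ∀ {k} → k < 0ℤ → Maya [] k
  witness { -[1+ t ]} _        = suc t , s≤s z≤n , refl
  witness {+ _}       (+<+ ())

maya-∷ : ∀ {x xs k} → Maya (x ∷ xs) k ⇔ (k ≡ + x - 1ℤ ⊎ Maya xs (k + 1ℤ))
maya-∷ {x} {xs} {k} = mk⇔ split join
  where
  open ≡-Reasoning
  step : ∀ e s → e - (1ℤ + (1ℤ + s)) + 1ℤ ≡ e - (1ℤ + s)
  step = solve-∀
  unstep : ∀ e s → e - (1ℤ + s) ≡ k + 1ℤ → e - (1ℤ + (1ℤ + s)) ≡ k
  unstep e s eq = begin
    e - (1ℤ + (1ℤ + s)) ≡⟨ solve (e ∷ s ∷ []) ⟩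
    e - (1ℤ + s) - 1ℤ   ≡⟨ cong (_- 1ℤ) eq ⟩
    k + 1ℤ - 1ℤ         ≡⟨ solve (k ∷ []) ⟩
    k                   ∎
  split : Maya (x ∷ xs) k → k ≡ + x - 1ℤ ⊎ Maya xs (k + 1ℤ)
  split (suc zero    , _ , eq)   = inj₁ (sym eq)
  split (suc (suc s) , _ , refl) = inj₂ (suc s , s≤s z≤n , sym (step (+ entry xs (suc s)) (+ s)))
  join : k ≡ + x - 1ℤ ⊎ Maya xs (k + 1ℤ) → Maya (x ∷ xs) k
  join (inj₁ eq)               = 1 , s≤s z≤n , sym eq
  join (inj₂ (suc s , _ , eq)) = suc (suc s) , s≤s z≤n , unstep (+ entry xs (suc s)) (+ s) eq

maya-∷-1 : ∀ {x xs j} → Maya (x ∷ xs) (j - 1ℤ) ⇔ (j ≡ + x ⊎ Maya xs j)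
maya-∷-1 {x} {xs} {j} = ⇔.trans maya-∷ (-1≡-1⇔≡ ⊎-⇔ ≡⇒ (cong (Maya xs) (arith j)))
  where
  arith : ∀ j → j - 1ℤ + 1ℤ ≡ j
  arith = solve-∀

maya-bounded : ∀ {x L v} → All (ℕ._≤ x) L → Maya L v → v < + x
maya-bounded {L = []} _ v∈ = ℤ.<-≤-trans (to maya-[] v∈) (+≤+ z≤n)
maya-bounded {L = y ∷ ys} {v} (y≤x All.∷ ys≤x) v∈ with to maya-∷ v∈
... | inj₁ refl = ℤ.<-≤-trans (i-1<i (+ y)) (+≤+ y≤x)
... | inj₂ v+1∈ = ℤ.<-trans (i<i+1 v) (maya-bounded ys≤x v+1∈)

maya? : ∀ L → Decidable (Maya L)
maya? []       k = map′ (from maya-[]) (to maya-[]) (k ℤ.<? 0ℤ)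
maya? (x ∷ xs) k = map′ (from maya-∷) (to maya-∷) (k ℤ.≟ + x - 1ℤ ⊎-dec maya? xs (k + 1ℤ))

-- Charges

Pos-resp : ∀ {S T} → S ≐ T → Pos S ≐ Pos T
Pos-resp S≐T k = S≐T k ×-⇔ ⇔.refl

Neg-resp : ∀ {S T} → S ≐ T → Neg S ≐ Neg T
Neg-resp S≐T k = ¬-cong-⇔ (S≐T k) ×-⇔ ⇔.refl

hasCharge-resp : ∀ {S T c} → S ≐ T → HasCharge S c → HasCharge T c
hasCharge-resp S≐T (P , N , P! , N! , P≐ , N≐ , c≡) =
  P , N , P! , N! , (λ k → ⇔.trans (P≐ k) (Pos-resp S≐T k)) , (λ k → ⇔.trans (N≐ k) (Neg-resp S≐T k)) , c≡

hasCharge-< : ∀ c → HasCharge (_< c) c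
hasCharge-< (+ n) =
  applyUpTo +_ n , [] , Unique.applyUpTo⁺₁ +_ n (λ i<j _ → ℕ.<⇒≢ i<j ∘ ℤ.+-injective) , AllPairs.[] ,
  (λ _ → mk⇔ pos⁺ pos⁻) ,
  (λ _ → mk⇔ (λ ()) λ (k≮n , k<0) → contradiction (ℤ.<-≤-trans k<0 (+≤+ z≤n)) k≮n) ,
  sym (trans (ℤ.+-identityʳ _) (cong +_ (length-applyUpTo +_ n)))
  where
  pos⁺ : ∀ {k} → k ∈ applyUpTo +_ n → Pos (_< + n) k
  pos⁺ k∈ with i , i<n , refl ← ∈-applyUpTo⁻ +_ k∈ = +<+ i<n , +≤+ z≤n
  pos⁻ : ∀ {k} → Pos (_< + n) k → k ∈ applyUpTo +_ n
  pos⁻ (+<+ i<n , +≤+ _) = ∈-applyUpTo⁺ +_ i<n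
hasCharge-< -[1+ n ] =
  [] , applyUpTo -[1+_] (suc n) , AllPairs.[] , Unique.applyUpTo⁺₁ -[1+_] (suc n) (λ i<j _ → ℕ.<⇒≢ i<j ∘ ℤ.-[1+-injective) ,
  (λ _ → mk⇔ (λ ()) λ (k<c , 0≤k) → contradiction (ℤ.≤-<-trans 0≤k (ℤ.<-trans k<c -<+)) (ℤ.<-irrefl refl)) ,
  (λ _ → mk⇔ neg⁺ neg⁻) ,
  cong (λ m → 0ℤ - + m) (sym (length-applyUpTo -[1+_] (suc n)))
  where
  neg⁺ : ∀ {k} → k ∈ applyUpTo -[1+_] (suc n) → Neg (_< -[1+ n ]) k
  neg⁺ k∈ with i , i<1+n , refl ← ∈-applyUpTo⁻ -[1+_] k∈ = (λ { (-<- n<i) → ℕ.<⇒≱ n<i (ℕ.≤-pred i<1+n) }) , -<+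
  neg⁻ : ∀ {k} → Neg (_< -[1+ n ]) k → k ∈ applyUpTo -[1+_] (suc n)
  neg⁻ { -[1+ i ]} (k≮c , _)     = ∈-applyUpTo⁺ -[1+_] (s≤s (ℕ.≮⇒≥ (k≮c ∘ -<-)))
  neg⁻ {+ _}       (_ , +<+ ())

hasCharge-insert-nonneg : ∀ {V c a} → HasCharge V c → ¬ V a → 0ℤ ≤ a → HasCharge (λ k → k ≡ a ⊎ V k) (c + 1ℤ)
hasCharge-insert-nonneg {V} {c} {a} (P , N , P! , N! , P≐ , N≐ , c≡) a∉V 0≤a =
  a ∷ P , N , All.tabulate a∉P AllPairs.∷ P! , N! , (λ _ → mk⇔ pos⁺ pos⁻) , (λ _ → mk⇔ neg⁺ neg⁻) ,
  trans (cong (_+ 1ℤ) c≡) (arith (+ length P) (+ length N))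
  where
  U = λ k → k ≡ a ⊎ V k
  arith : ∀ p n → p - n + 1ℤ ≡ 1ℤ + p - n
  arith = solve-∀
  a∉P : ∀ {k} → k ∈ P → a ≢ k
  a∉P k∈P refl = a∉V (proj₁ (to (P≐ _) k∈P))
  pos⁺ : ∀ {k} → k ∈ a ∷ P → Pos U k
  pos⁺ (here refl)  = inj₁ refl , 0≤a
  pos⁺ (there k∈P) = map₁ inj₂ (to (P≐ _) k∈P)
  pos⁻ : ∀ {k} → Pos U k → k ∈ a ∷ P
  pos⁻ (inj₁ refl , _) = here refl
  pos⁻ (inj₂ v , 0≤k)  = there (from (P≐ _) (v , 0≤k))
  neg⁺ : ∀ {k} → k ∈ N → Neg U k
  neg⁺ k∈N with k∉V , k<0 ← to (N≐ _) k∈N = [ (λ { refl → ℤ.<-irrefl refl (ℤ.<-≤-trans k<0 0≤a) }) , k∉V ] , k<0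
  neg⁻ : ∀ {k} → Neg U k → k ∈ N
  neg⁻ (k∉U , k<0) = from (N≐ _) (k∉U ∘ inj₂ , k<0)

hasCharge-insert-neg : ∀ {V c a} → HasCharge V c → ¬ V a → a < 0ℤ → HasCharge (λ k → k ≡ a ⊎ V k) (c + 1ℤ)
hasCharge-insert-neg {V} {c} {a} (P , N , P! , N! , P≐ , N≐ , c≡) a∉V a<0 =
  P , N∖a , P! , Unique.filter⁺ _ N! , (λ _ → mk⇔ pos⁺ pos⁻) , (λ _ → mk⇔ neg⁺ neg⁻) , (begin
    c + 1ℤ                                 ≡⟨ cong (_+ 1ℤ) c≡ ⟩
    + length P - + length N + 1ℤ           ≡⟨ cong (λ n → + length P - + n + 1ℤ) (length-remove ℤ._≟_ N! a∈N) ⟩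
    + length P - (1ℤ + + length N∖a) + 1ℤ  ≡⟨ arith (+ length P) (+ length N∖a) ⟩
    + length P - + length N∖a              ∎)
  where
  open ≡-Reasoning
  U = λ k → k ≡ a ⊎ V k
  N∖a = remove ℤ._≟_ a N
  arith : ∀ p r → p - (1ℤ + r) + 1ℤ ≡ p - r
  arith = solve-∀
  a∈N : a ∈ N
  a∈N = from (N≐ a) (a∉V , a<0)
  pos⁺ : ∀ {k} → k ∈ P → Pos U k
  pos⁺ k∈P = map₁ inj₂ (to (P≐ _) k∈P)
  pos⁻ : ∀ {k} → Pos U k → k ∈ P
  pos⁻ (inj₁ refl , 0≤a) = contradiction a<0 (ℤ.≤⇒≯ 0≤a)
  pos⁻ (inj₂ v , 0≤k)    = from (P≐ _) (v , 0≤k)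
  neg⁺ : ∀ {k} → k ∈ N∖a → Neg U k
  neg⁺ k∈ with k∈N , k≢a ← ∈-filter⁻ _ k∈ with k∉V , k<0 ← to (N≐ _) k∈N = [ k≢a , k∉V ] , k<0
  neg⁻ : ∀ {k} → Neg U k → k ∈ N∖a
  neg⁻ (k∉U , k<0) = ∈-filter⁺ _ (from (N≐ _) (k∉U ∘ inj₂ , k<0)) (k∉U ∘ inj₁)

hasCharge-insert : ∀ {V c a} → HasCharge V c → ¬ V a → HasCharge (λ k → k ≡ a ⊎ V k) (c + 1ℤ)
hasCharge-insert {a = a} charge a∉V with 0ℤ ℤ.≤? a
... | yes 0≤a = hasCharge-insert-nonneg charge a∉V 0≤a
... | no  0≰a = hasCharge-insert-neg charge a∉V (ℤ.≰⇒> 0≰a)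

hasCharge-maya : ∀ {ν} → Linked ℕ._≥_ ν → ∀ c → HasCharge (λ k → Maya ν (k - c)) c
hasCharge-maya {[]} _ c =
  hasCharge-resp (λ _ → ⇔.sym (⇔.trans maya-[] (mk⇔ -<0⇒< <⇒-<0))) (hasCharge-< c)
hasCharge-maya {x ∷ xs} ν↓ c =
  subst (HasCharge _) (arith₁ c) (hasCharge-resp decompose (hasCharge-insert IH a∉V))
  where
  arith₁ : ∀ c → c - 1ℤ + 1ℤ ≡ c
  arith₁ = solve-∀
  arith₂ : ∀ c x → c + (x - 1ℤ) - (c - 1ℤ) ≡ x
  arith₂ = solve-∀
  arith₃ : ∀ k c → k - c + 1ℤ ≡ k - (c - 1ℤ)
  arith₃ = solve-∀
  IH : HasCharge (λ k → Maya xs (k - (c - 1ℤ))) (c - 1ℤ)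
  IH = hasCharge-maya (Linked.tail ν↓) (c - 1ℤ)
  a = c + (+ x - 1ℤ)
  a∉V : ¬ Maya xs (a - (c - 1ℤ))
  a∉V a∈ = ℤ.<-irrefl refl (maya-bounded (All.tail (linked⇒bounded ν↓)) (subst (Maya xs) (arith₂ c (+ x)) a∈))
  decompose : (λ k → k ≡ a ⊎ Maya xs (k - (c - 1ℤ))) ≐ (λ k → Maya (x ∷ xs) (k - c))
  decompose k = ⇔.sym (⇔.trans maya-∷ (-≡⇔≡+ ⊎-⇔ ≡⇒ (cong (Maya xs) (arith₃ k c))))

associated : ∀ {S ν c} → IsPartition ν → (∀ k → Maya ν k ⇔ S (k + c)) → IsAssociated S ν
associated {S} {ν} {c} ν-part S-shape =
  ν-part , c , hasCharge-resp S≐ (hasCharge-maya (proj₁ ν-part) c) , S-shape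
  where
  arith : ∀ k c → k - c + c ≡ k
  arith = solve-∀
  S≐ : (λ k → Maya ν (k - c)) ≐ S
  S≐ k = ⇔.trans (S-shape (k - c)) (≡⇒ (cong S (arith k c)))

associated-resp : ∀ {S T ν} → S ≐ T → IsAssociated S ν → IsAssociated T ν
associated-resp S≐T (ν-part , c , charge , S-shape) =
  ν-part , c , hasCharge-resp S≐T charge , λ k → ⇔.trans (S-shape k) (S≐T _)

-- Conjugation

colLength : List ℕ → ℕ → ℕ
colLength L t = length (filter (t ℕ.≤?_) L)

colLength-antitone : ∀ L {t t′} → t ℕ.≤ t′ → colLength L t′ ℕ.≤ colLength L t
colLength-antitone L {t} {t′} t≤t′ =
  Sublist.length-mono-≤ (Sublist.⊆-filter-Sublist (t′ ℕ.≤?_) (t ℕ.≤?_) (λ { refl → ℕ.≤-trans t≤t′ }) (⊆-refl {x = L}))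

colLength-∷ : ∀ {t x xs} → t ℕ.≤ x → colLength (x ∷ xs) t ≡ suc (colLength xs t)
colLength-∷ {t} t≤x = cong length (filter-accept (t ℕ.≤?_) t≤x)

colLength-above : ∀ {x t L} → All (ℕ._≤ x) L → x ℕ.< t → colLength L t ≡ 0
colLength-above {t = t} L≤x x<t =
  cong length (filter-none (t ℕ.≤?_) (All.map (λ y≤x → ℕ.<⇒≱ (ℕ.≤-<-trans y≤x x<t)) L≤x))

entry-applyUpTo-< : ∀ f {n t} → t ℕ.< n → entry (applyUpTo f n) (suc t) ≡ f t
entry-applyUpTo-< f {suc n} {zero}  _         = refl
entry-applyUpTo-< f {suc n} {suc t} (s≤s t<n) = entry-applyUpTo-< (f ∘ suc) t<n

entry-applyUpTo-≥ : ∀ f {n t} → n ℕ.≤ t → entry (applyUpTo f n) (suc t) ≡ 0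
entry-applyUpTo-≥ f {zero}          _         = refl
entry-applyUpTo-≥ f {suc n} {suc t} (s≤s n≤t) = entry-applyUpTo-≥ (f ∘ suc) n≤t

entry-conj : ∀ {L} → Linked ℕ._≥_ L → ∀ t → entry (conj L) (suc t) ≡ colLength L (suc t)
entry-conj {[]}     _  t = refl
entry-conj {l ∷ ls} L↓ t with t ℕ.<? l
... | yes t<l = entry-applyUpTo-< _ t<l
... | no  t≮l = trans (entry-applyUpTo-≥ _ (ℕ.≮⇒≥ t≮l))
                      (sym (colLength-above (linked⇒bounded L↓) (s≤s (ℕ.≮⇒≥ t≮l))))

conj-isPartition : ∀ L → IsPartition (conj L)
conj-isPartition []       = Linked.[] , All.[]
conj-isPartition (l ∷ ls) =
  Linked.applyUpTo⁺₂ _ l (λ i → colLength-antitone (l ∷ ls) (ℕ.n≤1+n (suc i))) ,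
  All.applyUpTo⁺₁ _ l (λ i<l → subst (0 ℕ.<_) (sym (colLength-∷ i<l)) (s≤s z≤n))

conj-nonempty : ∀ {μ} → IsPartition μ → μ ≢ [] → conj μ ≢ []
conj-nonempty {[]}         _                μ≢[] = μ≢[]
conj-nonempty {suc x ∷ xs} _                _    = λ ()
conj-nonempty {zero ∷ xs}  (_ , () All.∷ _) _

-- Maya L is definitionally MayaOf (entry L).
MayaOf : (ℕ → ℕ) → HSet
MayaOf f k = ∃[ t ] (1 ℕ.≤ t × (+ f t) - (+ t) ≡ k)

mayaOf-cong : ∀ {f g} → (∀ t → f (suc t) ≡ g (suc t)) → MayaOf f ≐ MayaOf g
mayaOf-cong f≗g k = mk⇔ (λ { (suc t , 1≤t , refl) → suc t , 1≤t , cong (λ n → + n - + suc t) (sym (f≗g t)) })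
                        (λ { (suc t , 1≤t , refl) → suc t , 1≤t , cong (λ n → + n - + suc t) (f≗g t) })

colMaya-∷⁻ : ∀ {x xs k} → All (ℕ._≤ x) xs →
             MayaOf (colLength (x ∷ xs)) k → k ≢ - + x × MayaOf (colLength xs) (k - 1ℤ)
colMaya-∷⁻ {x} {xs} xs≤x (t , 1≤t , refl) with t ℕ.≤? x
... | yes t≤x rewrite colLength-∷ {xs = xs} t≤x =
  (λ eq → ℕ.<⇒≱ (s≤s (ℕ.m≤n+m x c)) (subst (ℕ._≤ x) (sym (ℤ.+-injective (-≡-⇒+≡ (+ suc c) (+ t) eq))) t≤x)) ,
  (t , 1≤t , arith (+ c) (+ t))
  where
  c = colLength xs t
  arith : ∀ c t → c - t ≡ 1ℤ + c - t - 1ℤ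
  arith = solve-∀
... | no t≰x rewrite colLength-above (ℕ.≤-refl All.∷ xs≤x) (ℕ.≰⇒> t≰x) =
  (λ eq → t≰x (ℕ.≤-reflexive (sym (ℤ.+-injective (-≡-⇒+≡ 0ℤ (+ t) eq))))) ,
  (suc t , s≤s z≤n , trans (cong (λ n → + n - + suc t) (colLength-above xs≤x (ℕ.m<n⇒m<1+n (ℕ.≰⇒> t≰x))))
                           (arith (+ t)))
  where
  arith : ∀ t → 0ℤ - (1ℤ + t) ≡ 0ℤ - t - 1ℤ
  arith = solve-∀

colMaya-∷⁺ : ∀ {x xs k} → All (ℕ._≤ x) xs →
             k ≢ - + x × MayaOf (colLength xs) (k - 1ℤ) → MayaOf (colLength (x ∷ xs)) k
colMaya-∷⁺ _ (_ , zero , () , _)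
colMaya-∷⁺ {x} {xs} {k} xs≤x (k≢-x , t@(suc t′) , 1≤t , eq) with t ℕ.≤? x
... | yes t≤x = t , 1≤t , (begin
  + colLength (x ∷ xs) t - + t    ≡⟨ cong (λ n → + n - + t) (colLength-∷ t≤x) ⟩
  1ℤ + + colLength xs t - + t     ≡⟨ ℤ.+-assoc 1ℤ (+ colLength xs t) (- + t) ⟩
  1ℤ + (+ colLength xs t - + t)   ≡⟨ to -≡⇔≡+ (sym eq) ⟨
  k                               ∎)
  where open ≡-Reasoning
... | no t≰x = t′ , ℕ.≤-<-trans z≤n x<t′ ,
               trans (cong (λ n → + n - + t′) (colLength-above (ℕ.≤-refl All.∷ xs≤x) x<t′)) (sym k≡)
  where
  arith : ∀ t → 1ℤ + (0ℤ - (1ℤ + t)) ≡ 0ℤ - t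
  arith = solve-∀
  k≡ : k ≡ 0ℤ - + t′
  k≡ = trans (to -≡⇔≡+ (trans (sym eq) (cong (λ n → + n - + t) (colLength-above xs≤x (ℕ.≰⇒> t≰x)))))
             (arith (+ t′))
  x<t′ : x ℕ.< t′
  x<t′ = ℕ.≤∧≢⇒< (ℕ.≤-pred (ℕ.≰⇒> t≰x)) λ { refl → k≢-x (trans k≡ (ℤ.+-identityˡ (- + x))) }

maya-[]-dual : Maya [] ≐ Dual (Maya [])
maya-[]-dual k = ⇔.trans maya-[] (⇔.trans (mk⇔ sign⁺ sign⁻) (¬-cong-⇔ (⇔.sym maya-[])))
  where
  sign⁺ : k < 0ℤ → ¬ mirror k < 0ℤ
  sign⁺ k<0 m<0 = ℤ.<⇒≱ m<0 (<0⇒0≤mirror k<0)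
  sign⁻ : ¬ mirror k < 0ℤ → k < 0ℤ
  sign⁻ m≮0 = ℤ.≰⇒> (m≮0 ∘ 0≤⇒mirror<0)

colMaya-dual : ∀ {L} → Linked ℕ._≥_ L → MayaOf (colLength L) ≐ Dual (Maya L)
colMaya-dual {[]}     _  = maya-[]-dual
colMaya-dual {x ∷ xs} L↓ k = begin
  MayaOf (colLength (x ∷ xs)) k                         ∼⟨ mk⇔ (colMaya-∷⁻ xs≤x) (colMaya-∷⁺ xs≤x) ⟩
  (k ≢ - + x × MayaOf (colLength xs) (k - 1ℤ))          ∼⟨ ¬-cong-⇔ mirror-≡ ×-⇔ colMaya-dual (Linked.tail L↓) (k - 1ℤ) ⟩
  (mirror k ≢ + x - 1ℤ × ¬ Maya xs (mirror (k - 1ℤ)))   ≡⟨ cong (λ m → mirror k ≢ + x - 1ℤ × ¬ Maya xs m) (mirror-shift k 1ℤ) ⟩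
  (mirror k ≢ + x - 1ℤ × ¬ Maya xs (mirror k + 1ℤ))     ∼⟨ mk⇔ (λ (p , q) → [ p , q ]) (λ r → r ∘ inj₁ , r ∘ inj₂) ⟩
  ¬ (mirror k ≡ + x - 1ℤ ⊎ Maya xs (mirror k + 1ℤ))     ∼⟨ ¬-cong-⇔ (⇔.sym maya-∷) ⟩
  Dual (Maya (x ∷ xs)) k                                ∎
  where
  open EquationalReasoning
  xs≤x = All.tail (linked⇒bounded L↓)
  mirror-≡ : (k ≡ - + x) ⇔ (mirror k ≡ + x - 1ℤ)
  mirror-≡ = mk⇔ (λ { refl → mirror-neg (+ x) }) (λ eq → mirror-injective (trans eq (sym (mirror-neg (+ x)))))

conj-dual : ∀ {L} → Linked ℕ._≥_ L → Maya (conj L) ≐ Dual (Maya L)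
conj-dual L↓ k = ⇔.trans (mayaOf-cong (entry-conj L↓) k) (colMaya-dual L↓ k)

associated-dual : ∀ {S ν} → IsAssociated S ν → IsAssociated (Dual S) (conj ν)
associated-dual {S} {ν} (ν-part , c , _ , S-shape) = associated (conj-isPartition ν) λ j → begin
  Maya (conj ν) j       ∼⟨ conj-dual (proj₁ ν-part) j ⟩
  ¬ Maya ν (mirror j)   ∼⟨ ¬-cong-⇔ (S-shape (mirror j)) ⟩
  ¬ S (mirror j + c)    ≡⟨ cong (¬_ ∘ S) (mirror-shift j c) ⟨
  Dual S (j - c)        ∎
  where open EquationalReasoning

-- Row removal and column addition

RowRemoval : HSet → List ℕ → Set
RowRemoval S ν = Σ ℤ λ m → IsMin (Pos S) m × IsAssociated (λ k → S k × k ≢ m) ν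

ColAddition : HSet → List ℕ → Set
ColAddition S ν = Σ ℤ λ m → IsMax (Neg S) m × IsAssociated (λ k → S k ⊎ k ≡ m) ν

rowRemoval-resp : ∀ {S T ν} → S ≐ T → RowRemoval S ν → RowRemoval T ν
rowRemoval-resp S≐T (m , (m∈ , m-min) , assoc) =
  m , (to (Pos-resp S≐T m) m∈ , λ k → m-min k ∘ from (Pos-resp S≐T k)) ,
  associated-resp (λ k → S≐T k ×-⇔ ⇔.refl) assoc

colAddition-resp : ∀ {S T ν} → S ≐ T → ColAddition S ν → ColAddition T ν
colAddition-resp S≐T (m , (m∈ , m-max) , assoc) =
  m , (to (Neg-resp S≐T m) m∈ , λ k → m-max k ∘ from (Neg-resp S≐T k)) ,
  associated-resp (λ k → S≐T k ⊎-⇔ ⇔.refl) assoc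

colAddition-dual : ∀ {S ν} → ColAddition S ν → RowRemoval (Dual S) (conj ν)
colAddition-dual {S} (m , m-max , assoc) =
  mirror m , isMax-Neg⇒isMin-Pos-Dual m-max , associated-resp (Dual-insert {S}) (associated-dual assoc)

rowRemoval-dual : ∀ {S ν} → RowRemoval S ν → ColAddition (Dual S) (conj ν)
rowRemoval-dual {S} (m , m-min , assoc) =
  mirror m , isMin-Pos⇒isMax-Neg-Dual m-min , associated-resp (Dual-delete {S}) (associated-dual assoc)

-- For the rows x ∷ ys of a partition, the first of index i + 1 ≤ x: delete the last row d with
-- λ_d ≥ d and add a box to every row above it.  removedPoint is λ_d - d, seen in S(x ∷ ys).
removeDurfeeRow : ℕ → ℕ → List ℕ → List ℕ
removeDurfeeRow i x []       = []
removeDurfeeRow i x (y ∷ ys) with suc i ℕ.<? y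
... | yes _ = suc x ∷ removeDurfeeRow (suc i) y ys
... | no  _ = y ∷ ys

removedPoint : ℕ → ℕ → List ℕ → ℤ
removedPoint i x []       = + x - 1ℤ
removedPoint i x (y ∷ ys) with suc i ℕ.<? y
... | yes _ = removedPoint (suc i) y ys - 1ℤ
... | no  _ = + x - 1ℤ

removedPoint-min : ∀ {x ys i} → Linked ℕ._≥_ (x ∷ ys) → i ℕ.< x →
                   IsMin (λ v → Maya (x ∷ ys) v × + i ≤ v) (removedPoint i x ys)
removedPoint-min {x} {[]} {i} _ i<x = (from maya-∷ (inj₁ refl) , <⇒≤-1 (+<+ i<x)) , least
  where
  least : ∀ v → Maya (x ∷ []) v × + i ≤ v → + x - 1ℤ ≤ v
  least v (v∈ , i≤v) with to maya-∷ v∈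
  ... | inj₁ refl = ℤ.≤-refl
  ... | inj₂ v+1∈ = contradiction (ℤ.<-trans (i<i+1 v) (to maya-[] v+1∈)) (ℤ.≤⇒≯ (ℤ.≤-trans (+≤+ z≤n) i≤v))
removedPoint-min {x} {y ∷ ys} {i} L↓ i<x with suc i ℕ.<? y
... | yes 1+i<y =
  (from maya-∷ (inj₂ (subst (Maya (y ∷ ys)) (sym (arith m′)) m′∈)) , <⇒≤-1 (ℤ.suc[i]≤j⇒i<j 1+i≤m′)) , least
  where
  arith : ∀ m → m - 1ℤ + 1ℤ ≡ m
  arith = solve-∀
  m′ = removedPoint (suc i) y ys
  IH = removedPoint-min (Linked.tail L↓) 1+i<y
  m′∈ = proj₁ (proj₁ IH)
  1+i≤m′ = proj₂ (proj₁ IH)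
  least : ∀ v → Maya (x ∷ y ∷ ys) v × + i ≤ v → m′ - 1ℤ ≤ v
  least v (v∈ , i≤v) with to maya-∷ v∈
  ... | inj₁ refl = ≤⇒-1≤-1 (ℤ.<⇒≤ (maya-bounded (All.tail (linked⇒bounded L↓)) m′∈))
  ... | inj₂ v+1∈ = ≤+1⇒-1≤ (proj₂ IH (v + 1ℤ) (v+1∈ , ≤⇒1+≤+1 i≤v))
... | no 1+i≮y = (from maya-∷ (inj₁ refl) , <⇒≤-1 (+<+ i<x)) , least
  where
  least : ∀ v → Maya (x ∷ y ∷ ys) v × + i ≤ v → + x - 1ℤ ≤ v
  least v (v∈ , i≤v) with to maya-∷ v∈
  ... | inj₁ refl = ℤ.≤-refl
  ... | inj₂ v+1∈ = contradiction (ℤ.<-≤-trans (maya-bounded (linked⇒bounded (Linked.tail L↓)) v+1∈) (+≤+ (ℕ.≮⇒≥ 1+i≮y)))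
                                  (ℤ.≤⇒≯ (≤⇒1+≤+1 i≤v))

removeDurfeeRow-isPartition : ∀ {x ys i} → IsPartition (x ∷ ys) →
  IsPartition (removeDurfeeRow i x ys) × All (ℕ._≤ suc x) (removeDurfeeRow i x ys)
removeDurfeeRow-isPartition {ys = []}         _                    = (Linked.[] , All.[]) , All.[]
removeDurfeeRow-isPartition {ys = y ∷ ys} {i} (L↓ , _ All.∷ 0<ys) with suc i ℕ.<? y
... | yes _ = (linked-∷ R≤1+x (proj₁ R-part) , s≤s z≤n All.∷ proj₂ R-part) , ℕ.≤-refl All.∷ R≤1+x
  where
  IH = removeDurfeeRow-isPartition (Linked.tail L↓ , 0<ys)
  R-part = proj₁ IH
  R≤1+x = All.map (λ z≤1+y → ℕ.≤-trans z≤1+y (s≤s (Linked.head L↓))) (proj₂ IH)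
... | no  _ = (Linked.tail L↓ , 0<ys) , All.map ℕ.m≤n⇒m≤1+n (All.tail (linked⇒bounded L↓))

maya-removeDurfeeRow : ∀ {x ys i} → Linked ℕ._≥_ (x ∷ ys) → ∀ j →
  Maya (removeDurfeeRow i x ys) j ⇔ (Maya (x ∷ ys) (j - 1ℤ) × j - 1ℤ ≢ removedPoint i x ys)
maya-removeDurfeeRow {x} {[]} _ j = begin
  Maya [] j                                    ∼⟨ absorb (λ j∈ j≡x → ℤ.<⇒≱ (to maya-[] j∈) (subst (0ℤ ≤_) (sym j≡x) (+≤+ z≤n))) ⟩
  ((j ≡ + x ⊎ Maya [] j) × j ≢ + x)            ∼⟨ ⇔.sym maya-∷-1 ×-⇔ ¬-cong-⇔ (⇔.sym -1≡-1⇔≡) ⟩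
  (Maya (x ∷ []) (j - 1ℤ) × j - 1ℤ ≢ + x - 1ℤ) ∎
  where open EquationalReasoning
maya-removeDurfeeRow {x} {y ∷ ys} {i} L↓ j with suc i ℕ.<? y
... | yes 1+i<y = begin
  Maya (suc x ∷ R) j                                            ∼⟨ maya-∷ ⟩
  (j ≡ + suc x - 1ℤ ⊎ Maya R (j + 1ℤ))                          ∼⟨ ≡⇒ (cong (j ≡_) (arith₁ (+ x))) ⊎-⇔ IH (j + 1ℤ) ⟩
  (j ≡ + x ⊎ (Maya (y ∷ ys) (j + 1ℤ - 1ℤ) × j + 1ℤ - 1ℤ ≢ m′)) ≡⟨ cong (λ k → j ≡ + x ⊎ (Maya (y ∷ ys) k × k ≢ m′)) (arith₂ j) ⟩
  (j ≡ + x ⊎ (Maya (y ∷ ys) j × j ≢ m′))                        ∼⟨ ⊎-×-distrib (λ { refl → ℤ.<⇒≢ m′<x ∘ sym }) ⟩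
  ((j ≡ + x ⊎ Maya (y ∷ ys) j) × j ≢ m′)                        ∼⟨ ⇔.sym maya-∷-1 ×-⇔ ¬-cong-⇔ (⇔.sym -1≡-1⇔≡) ⟩
  (Maya (x ∷ y ∷ ys) (j - 1ℤ) × j - 1ℤ ≢ m′ - 1ℤ)               ∎
  where
  open EquationalReasoning
  arith₁ : ∀ x → 1ℤ + x - 1ℤ ≡ x
  arith₁ = solve-∀
  arith₂ : ∀ j → j + 1ℤ - 1ℤ ≡ j
  arith₂ = solve-∀
  R  = removeDurfeeRow (suc i) y ys
  m′ = removedPoint (suc i) y ys
  IH = maya-removeDurfeeRow (Linked.tail L↓)
  m′<x : m′ < + x
  m′<x = maya-bounded (All.tail (linked⇒bounded L↓)) (proj₁ (proj₁ (removedPoint-min (Linked.tail L↓) 1+i<y)))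
... | no _ = begin
  Maya (y ∷ ys) j                                  ∼⟨ absorb (λ j∈ → ℤ.<⇒≢ (maya-bounded (All.tail (linked⇒bounded L↓)) j∈)) ⟩
  ((j ≡ + x ⊎ Maya (y ∷ ys) j) × j ≢ + x)          ∼⟨ ⇔.sym maya-∷-1 ×-⇔ ¬-cong-⇔ (⇔.sym -1≡-1⇔≡) ⟩
  (Maya (x ∷ y ∷ ys) (j - 1ℤ) × j - 1ℤ ≢ + x - 1ℤ) ∎
  where open EquationalReasoning

rowRemoval-exists : ∀ {μ} → IsPartition μ → μ ≢ [] → Σ (List ℕ) (RowRemoval (Maya μ))
rowRemoval-exists {[]}     _                          μ≢[] = contradiction refl μ≢[]
rowRemoval-exists {x ∷ xs} μ-part@(μ↓ , 0<x All.∷ _) _    =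
  removeDurfeeRow 0 x xs , removedPoint 0 x xs , removedPoint-min μ↓ 0<x ,
  associated (proj₁ (removeDurfeeRow-isPartition μ-part)) (maya-removeDurfeeRow μ↓)

colAddition-exists : ∀ {μ} → IsPartition μ → μ ≢ [] → Σ (List ℕ) (ColAddition (Maya μ))
colAddition-exists {μ} μ-part μ≢[]
  with ρ , ρ-row ← rowRemoval-exists (conj-isPartition μ) (conj-nonempty μ-part μ≢[]) =
  conj ρ , colAddition-resp (λ k → ⇔.trans (Dual-resp (conj-dual (proj₁ μ-part)) k) (Dual-involutive (maya? μ) k))
                            (rowRemoval-dual ρ-row)

colAddition-conj : ∀ {μ ν} → IsPartition μ → IsColAddition μ ν → IsRowRemoval (conj μ) (conj ν)
colAddition-conj μ-part = rowRemoval-resp (λ k → ⇔.sym (conj-dual (proj₁ μ-part) k)) ∘ colAddition-dual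

rowRemoval-conj : ∀ {μ ν} → IsPartition μ → IsRowRemoval μ ν → IsColAddition (conj μ) (conj ν)
rowRemoval-conj μ-part = colAddition-resp (λ k → ⇔.sym (conj-dual (proj₁ μ-part) k)) ∘ rowRemoval-dual

lemma5p24 : (μ : List ℕ) → IsPartition μ → μ ≢ [] →
    ((Σ (List ℕ) λ ν → IsColAddition μ ν)
      × (∀ ν → IsColAddition μ ν → IsRowRemoval (conj μ) (conj ν)))
    × ((Σ (List ℕ) λ ν → IsRowRemoval μ ν)
      × (∀ ν → IsRowRemoval μ ν → IsColAddition (conj μ) (conj ν)))
lemma5p24 μ μ-part μ≢[] =
  (colAddition-exists μ-part μ≢[] , λ _ → colAddition-conj μ-part) ,
  (rowRemoval-exists μ-part μ≢[] , λ _ → rowRemoval-conj μ-part)
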